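{- Let $n\ge 3$, let $1\le i_0<j_0\le n$ with $j_0\ge i_0+2$, let $\alpha=\varepsilon_{i_0}-\varepsilon_{j_0}$, $s=s_\alpha$, and let $w\in S_n$ satisfy $w(i_0)>w(j_0)$ and $w(j_0)<w(k)<w(i_0)$ for all $k$ with $i_0<k<j_0$; put $w'=ws$. Let $\beta$ be a bad negative root sharing the row of $\alpha$. Then $(\beta_1,\beta_2)\mapsto(\beta_1,s(\beta_2))$ is a bijection from $\mathfrak{A}_\beta$ onto the set of elements $(\beta_1,\beta_2)\in\mathfrak{A}_{s(\beta)}$ with $\beta_2\ne-\alpha$. Moreover, if $(\beta_1,\beta_2)\in\mathfrak{A}_\beta$ then $\beta_2$ is bad.
   Context: $S_n$ acts on $\mathbb{Z}^n$ by $w(\varepsilon_i)=\varepsilon_{w(i)}$. For $l\ne m$, $\alpha_{lm}=\varepsilon_l-\varepsilon_m$, positive if $l<m$, negative if $l>m$; $w(\alpha_{lm})=\alpha_{w(l)w(m)}$. $s=s_\alpha$ is the transposition $(i_0\,j_0)$, $s(\alpha_{lm})=\alpha_{s(l)s(m)}$. $\delta_P$ is $1$ if $P$ holds, else $0$. For a negative root $\beta=\alpha_{lm}$: it shares the row of $\alpha$ if $l=i_0$, the column of $\alpha$ if $m=j_0$, the row of $-\alpha$ if $l=j_0$, the column of $-\alpha$ if $m=i_0$. $\beta$ is bad if it shares the row or column of $\alpha$ and $\delta_{w(\beta)<0}=\delta_{w'(\beta)<0}$. Define $\kappa'_\beta=\delta_{w(\beta)<0}$ if $l=i_0$ or $m\in\{i_0,j_0\}$,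 and $\kappa'_\beta=\delta_{w'(\beta)<0}$ otherwise. $\mathfrak{D}_\beta=\{(\alpha_{km},\alpha_{lk}):m<k<l\}$, and for any negative root $\gamma$, $\mathfrak{A}_\gamma=\{(\gamma_1,\gamma_2)\in\mathfrak{D}_\gamma:\kappa'_\gamma=\kappa'_{\gamma_1}+\kappa'_{\gamma_2}\}$. -}

module Defs where

open import Data.Nat using (ℕ; _+_)
open import Data.Fin using (Fin; _<_)
open import Data.Fin.Properties using (_<?_; _≟_)
open import Data.Fin.Permutation using (Permutation′; _⟨$⟩ʳ_; transpose)
open import Data.Product using (Σ; _×_; _,_; proj₁; proj₂)
open import Data.Sum using (_⊎_)
open import Data.Bool using (Bool; if_then_else_; _∨_)
open import Relation.Nullary using (does)
open import Relation.Binary.PropositionalEquality using (_≡_)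

-- A root α_{lm} = ε_l − ε_m is represented by the pair (l , m).
-- Indices are 0-based (Fin n) instead of 1-based; this is an order-preserving shift.
Root : ℕ → Set
Root n = Fin n × Fin n

Negative : ∀ {n} → Root n → Set
Negative (l , m) = m < l

δneg : ∀ {n} → Root n → ℕ
δneg (l , m) = if does (m <? l) then 1 else 0

act : ∀ {n} → (Fin n → Fin n) → Root n → Root n
act u (l , m) = (u l , u m)

s : ∀ {n} → Fin n → Fin n → Fin n → Fin n
s i0 j0 k = transpose i0 j0 ⟨$⟩ʳ k

wf : ∀ {n} → Permutation′ n → Fin n → Fin n
wf w k = w ⟨$⟩ʳ k

w′ : ∀ {n} → Fin n → Fin n → Permutation′ n → Fin n → Fin n
w′ i0 j0 w k = w ⟨$⟩ʳ (s i0 j0 k)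

SharesRowα : ∀ {n} → Fin n → Fin n → Root n → Set
SharesRowα i0 j0 (l , m) = l ≡ i0

SharesColα : ∀ {n} → Fin n → Fin n → Root n → Set
SharesColα i0 j0 (l , m) = m ≡ j0

Bad : ∀ {n} → Fin n → Fin n → Permutation′ n → Root n → Set
Bad i0 j0 w β =
  Negative β × (SharesRowα i0 j0 β ⊎ SharesColα i0 j0 β)
  × δneg (act (wf w) β) ≡ δneg (act (w′ i0 j0 w) β)

κ′ : ∀ {n} → Fin n → Fin n → Permutation′ n → Root n → ℕ
κ′ i0 j0 w (l , m) =
  if does (l ≟ i0) ∨ does (m ≟ i0) ∨ does (m ≟ j0)
  then δneg (act (wf w) (l , m))
  else δneg (act (w′ i0 j0 w) (l , m))

𝔇 : ∀ {n} → Root n → Root n × Root n → Set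
𝔇 {n} (l , m) (γ₁ , γ₂) = Σ (Fin n) λ k → m < k × k < l × γ₁ ≡ (k , m) × γ₂ ≡ (l , k)

𝔄 : ∀ {n} → Fin n → Fin n → Permutation′ n → Root n → Root n × Root n → Set
𝔄 i0 j0 w γ (γ₁ , γ₂) =
  𝔇 γ (γ₁ , γ₂) × κ′ i0 j0 w γ ≡ κ′ i0 j0 w γ₁ + κ′ i0 j0 w γ₂

Φ : ∀ {n} → Fin n → Fin n → Root n × Root n → Root n × Root n
Φ i0 j0 (β₁ , β₂) = (β₁ , act (s i0 j0) β₂)

{-# OPTIONS --safe #-}
-- Write β = α_{i0 m} with m < i0, so s(β) = α_{j0 m}. For every k ∉ {i0, j0} the values of
-- κ′ at α_{i0 k} and α_{j0 k} coincide, so k splits β additively iff it splits s(β); this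
-- gives the bijection on all k < i0. The only other splittings of s(β) avoiding −α have
-- i0 < k < j0, hence w(j0) < w(k) < w(i0); such a k cannot split additively, because
-- badness of β says that w(m) lies on the same side of w(i0) and of w(j0). The same
-- obstruction forces w(k) ∉ (w(j0), w(i0)) when k splits β, which is badness of α_{i0 k}.
module Submission where

open import Defs
open import Data.Nat using (ℕ; _≤_; _+_)
open import Data.Fin using (Fin; toℕ; _<_)
open import Data.Fin.Permutation using (Permutation′; _⟨$⟩ʳ_)
open import Data.Fin.Properties using (_<?_; _≟_; <-cmp; <-trans; <-asym; <⇒≢)
open import Data.Product using (Σ; _×_; _,_; proj₁; proj₂)
open import Data.Sum using (inj₁)
open import Data.Empty using (⊥-elim)
open import Function using (id; _∘_)
open import Function.Bundles using (Injection)
open import Function.Properties.Inverse using (↔⇒↣)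
open import Relation.Nullary using (¬_; yes; no)
open import Relation.Nullary.Decidable using (dec-true; dec-false)
open import Relation.Binary using (tri<; tri≈; tri>)
open import Relation.Binary.PropositionalEquality

δneg-< : ∀ {n} {a b : Fin n} → b < a → δneg (a , b) ≡ 1
δneg-< {a = a} {b} b<a rewrite dec-true (b <? a) b<a = refl

δneg-≮ : ∀ {n} {a b : Fin n} → ¬ b < a → δneg (a , b) ≡ 0
δneg-≮ {a = a} {b} b≮a rewrite dec-false (b <? a) b≮a = refl

δneg-outside-interval : ∀ {n} {a b c : Fin n} → b < a → c ≢ a → c ≢ b
  → ¬ (b < c × c < a) → δneg (a , c) ≡ δneg (b , c)
δneg-outside-interval {a = a} {b} {c} b<a c≢a c≢b outside with <-cmp c b
... | tri< c<b _ _ = trans (δneg-< (<-trans c<b b<a)) (sym (δneg-< c<b))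
... | tri≈ _ c≡b _ = ⊥-elim (c≢b c≡b)
... | tri> _ _ b<c with <-cmp c a
...   | tri< c<a _ _ = ⊥-elim (outside (b<c , c<a))
...   | tri≈ _ c≡a _ = ⊥-elim (c≢a c≡a)
...   | tri> _ _ a<c = trans (δneg-≮ (<-asym a<c)) (sym (δneg-≮ (<-asym (<-trans b<a a<c))))

-- If d lies on the same side of a and of b, then δ(d < a) = δ(d < c) + 1 would put d
-- below a but above c, hence above b.
¬δneg-additive-between : ∀ {n} {a b c d : Fin n} → b < c → c < a
  → δneg (a , d) ≡ δneg (b , d) → δneg (a , d) ≢ δneg (c , d) + δneg (a , c)
¬δneg-additive-between {a = a} {b} {c} {d} b<c c<a same additive with d <? a | d <? b | d <? c
... | yes _   | yes d<b | no d≮c  = d≮c (<-trans d<b b<c)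
... | yes d<a | yes _   | yes d<c
  with () ← trans (sym (δneg-< d<a)) (trans additive (cong₂ _+_ (δneg-< d<c) (δneg-< c<a)))
... | yes d<a | no d≮b  | _       with () ← trans (sym (δneg-< d<a)) (trans same (δneg-≮ d≮b))
... | no d≮a  | _       | yes d<c
  with () ← trans (sym (δneg-≮ d≮a)) (trans additive (cong₂ _+_ (δneg-< d<c) (δneg-< c<a)))
... | no d≮a  | _       | no d≮c
  with () ← trans (sym (δneg-≮ d≮a)) (trans additive (cong₂ _+_ (δneg-≮ d≮c) (δneg-< c<a)))

module _ {n} {i0 j0 : Fin n} (i0<j0 : i0 < j0) where

  j0≢i0 : j0 ≢ i0
  j0≢i0 = λ j0≡i0 → <⇒≢ i0<j0 (sym j0≡i0)

  NotSwapped : Fin n → Set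
  NotSwapped x = x ≢ i0 × x ≢ j0

  <i0⇒NotSwapped : ∀ {x} → x < i0 → NotSwapped x
  <i0⇒NotSwapped x<i0 = <⇒≢ x<i0 , <⇒≢ (<-trans x<i0 i0<j0)

  s-i0 : s i0 j0 i0 ≡ j0
  s-i0 rewrite dec-true (i0 ≟ i0) refl = refl

  s-fix : ∀ {x} → NotSwapped x → s i0 j0 x ≡ x
  s-fix {x} (x≢i0 , x≢j0) rewrite dec-false (x ≟ i0) x≢i0 | dec-false (x ≟ j0) x≢j0 = refl

  s-j0 : s i0 j0 j0 ≡ i0
  s-j0 rewrite dec-false (j0 ≟ i0) j0≢i0 | dec-true (j0 ≟ j0) refl = refl

  act-s-row : ∀ {x} → NotSwapped x → act (s i0 j0) (i0 , x) ≡ (j0 , x)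
  act-s-row ns = cong₂ _,_ s-i0 (s-fix ns)

  𝔇-proj₁-injective : ∀ {γ : Root n} {p q} → 𝔇 γ p → 𝔇 γ q → proj₁ p ≡ proj₁ q → p ≡ q
  𝔇-proj₁-injective (_ , _ , _ , refl , refl) (_ , _ , _ , refl , refl) refl = refl

  module _ (w : Permutation′ n) where

    W : Fin n → Fin n
    W = w ⟨$⟩ʳ_

    W-injective : ∀ {x y} → W x ≡ W y → x ≡ y
    W-injective = Injection.injective (↔⇒↣ w)

    δneg-w′-row : ∀ {x} → NotSwapped x → δneg (act (w′ i0 j0 w) (i0 , x)) ≡ δneg (W j0 , W x)
    δneg-w′-row ns = cong₂ (λ a b → δneg (W a , W b)) s-i0 (s-fix ns)

    κ′-row : ∀ x → κ′ i0 j0 w (i0 , x) ≡ δneg (W i0 , W x)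
    κ′-row x rewrite dec-true (i0 ≟ i0) refl = refl

    κ′-off : ∀ {l x} → l ≢ i0 → NotSwapped x → κ′ i0 j0 w (l , x) ≡ δneg (act (w′ i0 j0 w) (l , x))
    κ′-off {l} {x} l≢i0 (x≢i0 , x≢j0)
      rewrite dec-false (l ≟ i0) l≢i0 | dec-false (x ≟ i0) x≢i0 | dec-false (x ≟ j0) x≢j0 = refl

    κ′-notSwapped : ∀ {l x} → NotSwapped l → NotSwapped x → κ′ i0 j0 w (l , x) ≡ δneg (W l , W x)
    κ′-notSwapped nsl nsx =
      trans (κ′-off (proj₁ nsl) nsx) (cong₂ (λ a b → δneg (W a , W b)) (s-fix nsl) (s-fix nsx))

    κ′-j0-row : ∀ {x} → NotSwapped x → κ′ i0 j0 w (j0 , x) ≡ κ′ i0 j0 w (i0 , x)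
    κ′-j0-row {x} ns = begin
      κ′ i0 j0 w (j0 , x)  ≡⟨ κ′-off j0≢i0 ns ⟩
      δneg (W (s i0 j0 j0) , W (s i0 j0 x))  ≡⟨ cong₂ (λ a b → δneg (W a , W b)) s-j0 (s-fix ns) ⟩
      δneg (W i0 , W x)  ≡⟨ sym (κ′-row x) ⟩
      κ′ i0 j0 w (i0 , x)  ∎
      where open ≡-Reasoning

    Additive : Fin n → Fin n → Fin n → Set
    Additive l k m = κ′ i0 j0 w (l , m) ≡ κ′ i0 j0 w (k , m) + κ′ i0 j0 w (l , k)

    Additive-j0≡i0 : ∀ {k m} → NotSwapped k → NotSwapped m → Additive j0 k m ≡ Additive i0 k m
    Additive-j0≡i0 {k} {m} nsk nsm =
      cong₂ (λ a b → a ≡ κ′ i0 j0 w (k , m) + b) (κ′-j0-row nsm) (κ′-j0-row nsk)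

    ¬Additive-between : ∀ {k m} → NotSwapped k → NotSwapped m
      → δneg (W i0 , W m) ≡ δneg (W j0 , W m) → W j0 < W k × W k < W i0 → ¬ Additive i0 k m
    ¬Additive-between {k} {m} nsk nsm same (j0<k , k<i0) additive =
      ¬δneg-additive-between j0<k k<i0 same (begin
        δneg (W i0 , W m)                          ≡⟨ sym (κ′-row m) ⟩
        κ′ i0 j0 w (i0 , m)                        ≡⟨ additive ⟩
        κ′ i0 j0 w (k , m) + κ′ i0 j0 w (i0 , k)   ≡⟨ cong₂ _+_ (κ′-notSwapped nsk nsm) (κ′-row k) ⟩
        δneg (W k , W m) + δneg (W i0 , W k)       ∎)
      where open ≡-Reasoning

    module _ {m : Fin n} (m<i0 : m < i0) where

      𝔄-row⇒𝔄-sRow : ∀ p → 𝔄 i0 j0 w (i0 , m) p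
        → 𝔄 i0 j0 w (act (s i0 j0) (i0 , m)) (Φ i0 j0 p) × proj₂ (Φ i0 j0 p) ≢ (j0 , i0)
      𝔄-row⇒𝔄-sRow _ ((k , m<k , k<i0 , refl , refl) , additive) =
        subst₂ (𝔄 i0 j0 w) (sym (act-s-row nsm)) (cong ((k , m) ,_) (sym (act-s-row nsk)))
          ((k , m<k , <-trans k<i0 i0<j0 , refl , refl)
          , subst id (sym (Additive-j0≡i0 nsk nsm)) additive)
        , λ sβ₂≡-α → proj₁ nsk (cong proj₂ (trans (sym (act-s-row nsk)) sβ₂≡-α))
        where
        nsk = <i0⇒NotSwapped k<i0
        nsm = <i0⇒NotSwapped m<i0

      module _ (same : δneg (W i0 , W m) ≡ δneg (W j0 , W m)) where

        𝔄-sRow⇒𝔄-row : (∀ k → i0 < k → k < j0 → W j0 < W k × W k < W i0)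
          → ∀ γ₁ γ₂ → 𝔄 i0 j0 w (act (s i0 j0) (i0 , m)) (γ₁ , γ₂) → γ₂ ≢ (j0 , i0)
          → Σ (Root n × Root n) λ p → 𝔄 i0 j0 w (i0 , m) p × Φ i0 j0 p ≡ (γ₁ , γ₂)
        𝔄-sRow⇒𝔄-row between γ₁ γ₂ a γ₂≢-α =
          split γ₁ γ₂ (subst (λ γ → 𝔄 i0 j0 w γ (γ₁ , γ₂)) (act-s-row nsm) a) γ₂≢-α
          where
          nsm = <i0⇒NotSwapped m<i0
          split : ∀ γ₁ γ₂ → 𝔄 i0 j0 w (j0 , m) (γ₁ , γ₂) → γ₂ ≢ (j0 , i0)
            → Σ (Root n × Root n) λ p → 𝔄 i0 j0 w (i0 , m) p × Φ i0 j0 p ≡ (γ₁ , γ₂)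
          split _ _ ((k , m<k , k<j0 , refl , refl) , additive) γ₂≢-α with <-cmp k i0
          ... | tri< k<i0 _ _ =
            ((k , m) , (i0 , k))
            , ((k , m<k , k<i0 , refl , refl) , subst id (Additive-j0≡i0 nsk nsm) additive)
            , cong ((k , m) ,_) (act-s-row nsk)
            where nsk = <i0⇒NotSwapped k<i0
          ... | tri≈ _ k≡i0 _ = ⊥-elim (γ₂≢-α (cong (j0 ,_) k≡i0))
          ... | tri> _ _ i0<k = ⊥-elim (¬Additive-between nsk nsm same (between k i0<k k<j0)
                                  (subst id (Additive-j0≡i0 nsk nsm) additive))
            where nsk = (λ k≡i0 → <⇒≢ i0<k (sym k≡i0)) , <⇒≢ k<j0

        𝔄-row⇒Bad : W j0 < W i0 → ∀ β₁ β₂ → 𝔄 i0 j0 w (i0 , m) (β₁ , β₂) → Bad i0 j0 w β₂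
        𝔄-row⇒Bad j0<i0 _ _ ((k , _ , k<i0 , refl , refl) , additive) =
          k<i0 , inj₁ refl ,
          trans (δneg-outside-interval j0<i0 (proj₁ nsk ∘ W-injective) (proj₂ nsk ∘ W-injective)
                  (λ between → ¬Additive-between nsk nsm same between additive))
                (sym (δneg-w′-row nsk))
          where
          nsk = <i0⇒NotSwapped k<i0
          nsm = <i0⇒NotSwapped m<i0

-- The hypotheses n ≥ 3 and j0 ≥ i0 + 2 only exclude degenerate configurations.
lemma3p2p4 : (n : ℕ) → 3 ≤ n → (i0 j0 : Fin n) → i0 < j0 → toℕ i0 + 2 ≤ toℕ j0
    → (w : Permutation′ n) → w ⟨$⟩ʳ j0 < w ⟨$⟩ʳ i0
    → (∀ k → i0 < k → k < j0 → (w ⟨$⟩ʳ j0 < w ⟨$⟩ʳ k) × (w ⟨$⟩ʳ k < w ⟨$⟩ʳ i0))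
    → (β : Root n) → Negative β → Bad i0 j0 w β → SharesRowα i0 j0 β
    → ((p : Root n × Root n) → 𝔄 i0 j0 w β p
    → 𝔄 i0 j0 w (act (s i0 j0) β) (Φ i0 j0 p)
    × proj₂ (Φ i0 j0 p) ≢ (j0 , i0))
    × ((p q : Root n × Root n) → 𝔄 i0 j0 w β p → 𝔄 i0 j0 w β q
    → Φ i0 j0 p ≡ Φ i0 j0 q → p ≡ q)
    × ((γ₁ γ₂ : Root n) → 𝔄 i0 j0 w (act (s i0 j0) β) (γ₁ , γ₂) → γ₂ ≢ (j0 , i0)
    → Σ (Root n × Root n) λ p → 𝔄 i0 j0 w β p × Φ i0 j0 p ≡ (γ₁ , γ₂))
    × ((β₁ β₂ : Root n) → 𝔄 i0 j0 w β (β₁ , β₂) → Bad i0 j0 w β₂)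
lemma3p2p4 n _ i0 j0 i0<j0 _ w j0<i0 between (.i0 , m) m<i0 (_ , _ , bad) refl =
  𝔄-row⇒𝔄-sRow i0<j0 w m<i0
  , (λ p q a b Φp≡Φq → 𝔇-proj₁-injective i0<j0 (proj₁ a) (proj₁ b) (cong proj₁ Φp≡Φq))
  , 𝔄-sRow⇒𝔄-row i0<j0 w m<i0 same between
  , 𝔄-row⇒Bad i0<j0 w m<i0 same j0<i0
  where
  same : δneg (w ⟨$⟩ʳ i0 , w ⟨$⟩ʳ m) ≡ δneg (w ⟨$⟩ʳ j0 , w ⟨$⟩ʳ m)
  same = trans bad (δneg-w′-row i0<j0 w (<i0⇒NotSwapped i0<j0 m<i0))
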